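{- Let $H$ be a graph, $r$ a positive integer, and $G=H^r$. For $v\in V(H)$ let $B_v=N_G(v)\cup\{v\}$. Suppose $v_0,v_1,\ldots,v_r$ are distinct vertices such that $B_{v_r}=\{v_0,v_1,\ldots,v_r\}$ and $B_{v_{i+1}}\subsetneq B_{v_i}$ for all $i=0,\ldots,r-1$. Then the subgraph of $H$ induced by $\{v_0,\ldots,v_r\}$ is the path $v_0-v_1-\cdots-v_r$, and for every $d=1,\ldots,r$ the set of vertices at distance exactly $d$ from $v_0$ in $H$ is $$\big(B_{v_{r-d}}\setminus B_{v_{r-d+1}}\big)\cup\{v_d\}.$$
   Context: All graphs are simple, undirected and connected. $H^r$ is the graph on $V(H)$ in which two distinct vertices are adjacent iff their distance in $H$ is at most $r$. $N_G(v)$ is the (open) neighbourhood of $v$ in $G$. -}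

module Defs where

open import Data.Nat using (ℕ; zero; suc; _≤_; _<_)
open import Data.Fin using (Fin)
open import Data.Sum using (_⊎_)
open import Data.Product using (Σ; ∃; _×_; _,_)
open import Relation.Nullary using (¬_; Dec)
open import Relation.Binary.PropositionalEquality using (_≡_)
open import Relation.Binary using (Decidable)

record Graph (n : ℕ) : Set₁ where
  field
    Adj   : Fin n → Fin n → Set
    adj?  : Decidable Adj
    sym   : ∀ {x y} → Adj x y → Adj y x
    irrefl : ∀ {x} → ¬ Adj x x
open Graph public

data Walk {n : ℕ} (H : Graph n) : Fin n → Fin n → ℕ → Set where
  [] : ∀ {u} → Walk H u u zero
  _∷_ : ∀ {u w v k} → Adj H u w → Walk H w v k → Walk H u v (suc k)

Connected : ∀ {n} → Graph n → Set
Connected H = ∀ u v → ∃ λ k → Walk H u v k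

DistLe : ∀ {n} → Graph n → Fin n → Fin n → ℕ → Set
DistLe H u v k = ∃ λ m → m ≤ k × Walk H u v m

DistEq : ∀ {n} → Graph n → Fin n → Fin n → ℕ → Set
DistEq H u v d = Walk H u v d × (∀ m → m < d → ¬ Walk H u v m)

AdjPow : ∀ {n} → Graph n → ℕ → Fin n → Fin n → Set
AdjPow H r x y = ¬ (x ≡ y) × DistLe H x y r

Ball : ∀ {n} → Graph n → ℕ → Fin n → Fin n → Set
Ball H r v x = AdjPow H r v x ⊎ x ≡ v

module Submission where

-- Work with the graph metric `dist` of H, so that B_v is the metric ball of
-- radius r about v.  Put a = v r.  Since B_{v r} ⊊ B_{v (r-1)}, some vertex w lies outside
-- B_a; the first r+1 vertices γ 0, …, γ r of a shortest walk from a to w are at distances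
-- 0, …, r from a and all lie in B_a = {v 0, …, v r}, so by pigeonhole B_a is exactly this
-- ray, and every vertex at distance k ≤ r from a is γ k.  Consequently shortest walks from a
-- pass through B_a along the ray: dist a y + dist y x = dist a x whenever y ∈ B_a is no
-- farther from a than x.  Comparing both sides at a witness of B_{v (i+1)} ⊊ B_{v i} shows
-- that pos i = dist a (v i) strictly decreases, and as pos 0 ≤ r this forces pos i = r - i.
-- Hence dist (v i) (v j) = |i - j|, which gives the induced path, and outside B_a the
-- distance from v i is dist (v 0) x + i, which identifies the spheres about v 0.

open import Defs
open import Data.Nat using (ℕ; zero; suc; _≤_; _<_; _+_; _∸_; z≤n; s≤s; s≤s⁻¹; _≤?_)
open import Data.Nat.Properties
open import Data.Fin using (Fin; toℕ; fromℕ<)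
import Data.Fin.Properties as Fin
open import Data.Product using (∃; _×_; _,_; proj₁; proj₂)
open import Data.Sum using (_⊎_; inj₁; inj₂)
open import Data.Empty using (⊥-elim)
open import Function using (_∘_)
open import Function.Bundles using (_⇔_; mk⇔; Equivalence)
open import Function.Construct.Composition using (_⇔-∘_)
open import Relation.Nullary using (¬_; Dec; yes; no)
open import Relation.Nullary.Decidable using (_×-dec_)
import Relation.Binary.PropositionalEquality as Eq
open Eq using (_≡_; refl; cong; subst; trans; module ≡-Reasoning)

open Equivalence using (to; from)

least-witness : {P : ℕ → Set} → (∀ m → Dec (P m)) → ∀ m → (∃ λ d → d < m × P d) →
                ∃ λ d → P d × (∀ d' → d' < d → ¬ P d')
least-witness P? (suc m) (d , d<1+m , Pd) with anyUpTo? P? m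
... | yes smaller = least-witness P? m smaller
... | no none = d , Pd , λ d' d'<d Pd' → none (d' , <-≤-trans d'<d (s≤s⁻¹ d<1+m) , Pd')

module _ (m : ℕ) (R : ℕ → ℕ → Set)
         (choose : ∀ t → t ≤ suc m → ∃ λ i → i ≤ m × R t i) where

  private
    bound : (t : Fin (suc (suc m))) → toℕ t ≤ suc m
    bound t = s≤s⁻¹ (Fin.toℕ<n t)

    index : Fin (suc (suc m)) → ℕ
    index t = proj₁ (choose (toℕ t) (bound t))

    index≤ : ∀ t → index t ≤ m
    index≤ t = proj₁ (proj₂ (choose (toℕ t) (bound t)))

    related : ∀ t → R (toℕ t) (index t)
    related t = proj₂ (proj₂ (choose (toℕ t) (bound t)))

    box : Fin (suc (suc m)) → Fin (suc m)
    box t = fromℕ< (s≤s (index≤ t))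

    same-box⇒same-index : ∀ s t → box s ≡ box t → index s ≡ index t
    same-box⇒same-index s t eq = trans (Eq.sym (Fin.toℕ-fromℕ< (s≤s (index≤ s))))
                                   (trans (cong toℕ eq) (Fin.toℕ-fromℕ< (s≤s (index≤ t))))

  pigeonhole : ∃ λ s → ∃ λ t → s < t × t ≤ suc m × ∃ λ i → R s i × R t i
  pigeonhole with Fin.pigeonhole (n<1+n (suc m)) box
  ... | s , t , s<t , eq =
    toℕ s , toℕ t , s<t , bound t , index s , related s ,
    subst (R (toℕ t)) (Eq.sym (same-box⇒same-index s t eq)) (related t)

-- If a ≤ s and b ≤ t while s + t ≤ a + b, both bounds are attained.
-- This is how a vertex on a shortest walk gets its exact distances to the ends.
tight-sum : ∀ {a b s t} → a ≤ s → b ≤ t → s + t ≤ a + b → a ≡ s × b ≡ t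
tight-sum {a} {b} {s} {t} a≤s b≤t s+t≤a+b =
  ≤-antisym a≤s (+-cancelʳ-≤ t s a (≤-trans s+t≤a+b (+-monoʳ-≤ a b≤t))) ,
  ≤-antisym b≤t (+-cancelˡ-≤ s t b (≤-trans s+t≤a+b (+-monoˡ-≤ b a≤s)))

descending-staircase : (g : ℕ → ℕ) (r : ℕ) →
                       (∀ i → i < r → g (suc i) < g i) → g 0 ≤ r →
                       ∀ i → i ≤ r → g i + i ≡ r
descending-staircase g r decreasing g0≤r i i≤r =
  ≤-antisym (≤-trans (upper i i≤r) g0≤r) (lower (r ∸ i) i (m+[n∸m]≡n i≤r))
  where
    step : ∀ i → i < r → g (suc i) + suc i ≤ g i + i
    step i i<r = ≤-trans (≤-reflexive (+-suc (g (suc i)) i)) (+-monoˡ-≤ i (decreasing i i<r))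

    upper : ∀ i → i ≤ r → g i + i ≤ g 0
    upper zero _ = ≤-reflexive (+-identityʳ (g 0))
    upper (suc i) 1+i≤r = ≤-trans (step i 1+i≤r) (upper i (≤-trans (n≤1+n i) 1+i≤r))

    lower : ∀ k i → i + k ≡ r → r ≤ g i + i
    lower zero i i+0≡r =
      subst (_≤ g i + i) (trans (Eq.sym (+-identityʳ i)) i+0≡r) (m≤n+m i (g i))
    lower (suc k) i i+1+k≡r =
      ≤-trans (lower k (suc i) (trans (Eq.sym (+-suc i k)) i+1+k≡r))
              (step i (subst (i <_) i+1+k≡r (m<m+n i (s≤s z≤n))))

shifted-bound : ∀ {m d r} → d ≤ r → m + (r ∸ d) ≤ r ⇔ m ≤ d
shifted-bound {m} {d} {r} d≤r = mk⇔
  (λ le → +-cancelʳ-≤ (r ∸ d) m d (≤-trans le (≤-reflexive (Eq.sym (m+[n∸m]≡n d≤r)))))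
  (λ le → ≤-trans (+-monoˡ-≤ (r ∸ d) le) (≤-reflexive (m+[n∸m]≡n d≤r)))

bound-by : ∀ {a b c} → a ≡ b → a ≤ c ⇔ b ≤ c
bound-by {c = c} a≡b = mk⇔ (subst (_≤ c) a≡b) (subst (_≤ c) (Eq.sym a≡b))

module Metric {n : ℕ} (H : Graph n) (connected : Connected H) where

  _▷_ : ∀ {u w v k} → Walk H u w k → Adj H w v → Walk H u v (suc k)
  [] ▷ e = e ∷ []
  (e ∷ p) ▷ e' = e ∷ (p ▷ e')

  reverse : ∀ {u v k} → Walk H u v k → Walk H v u k
  reverse [] = []
  reverse (e ∷ p) = reverse p ▷ sym H e

  _++_ : ∀ {u w v k m} → Walk H u w k → Walk H w v m → Walk H u v (k + m)
  [] ++ q = q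
  (e ∷ p) ++ q = e ∷ (p ++ q)

  vertexAt : ∀ {u v k} → Walk H u v k → ℕ → Fin n
  vertexAt {u} p zero = u
  vertexAt {u} [] (suc t) = u
  vertexAt (e ∷ p) (suc t) = vertexAt p t

  prefix : ∀ {u v k t} (p : Walk H u v k) → t ≤ k → Walk H u (vertexAt p t) t
  prefix p z≤n = []
  prefix (e ∷ p) (s≤s t≤k) = e ∷ prefix p t≤k

  suffix : ∀ {u v k t} (p : Walk H u v k) → t ≤ k → Walk H (vertexAt p t) v (k ∸ t)
  suffix p z≤n = p
  suffix (e ∷ p) (s≤s t≤k) = suffix p t≤k

  walk? : ∀ u v m → Dec (Walk H u v m)
  walk? u v zero with u Fin.≟ v
  ... | yes refl = yes []
  ... | no u≢v = no λ { [] → u≢v refl }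
  walk? u v (suc m) with Fin.any? (λ w → adj? H u w ×-dec walk? w v m)
  ... | yes (w , e , p) = yes (e ∷ p)
  ... | no none = no λ { (e ∷ p) → none (_ , e , p) }

  shortest : ∀ u v → ∃ λ d → Walk H u v d × (∀ d' → d' < d → ¬ Walk H u v d')
  shortest u v with connected u v
  ... | k , p = least-witness (walk? u v) (suc k) (k , ≤-refl , p)

  dist : Fin n → Fin n → ℕ
  dist u v = proj₁ (shortest u v)

  geodesic : ∀ u v → Walk H u v (dist u v)
  geodesic u v = proj₁ (proj₂ (shortest u v))

  dist-≤ : ∀ {u v m} → Walk H u v m → dist u v ≤ m
  dist-≤ {u} {v} {m} p with dist u v ≤? m
  ... | yes le = le
  ... | no nle = ⊥-elim (proj₂ (proj₂ (shortest u v)) m (≰⇒> nle) p)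

  dist-sym : ∀ u v → dist u v ≡ dist v u
  dist-sym u v = ≤-antisym (dist-≤ (reverse (geodesic v u))) (dist-≤ (reverse (geodesic u v)))

  dist-triangle : ∀ u w v → dist u v ≤ dist u w + dist w v
  dist-triangle u w v = dist-≤ (geodesic u w ++ geodesic w v)

  dist-self : ∀ u → dist u u ≡ 0
  dist-self u = n≤0⇒n≡0 (dist-≤ [])

  dist≡0⇒≡ : ∀ {u v} → dist u v ≡ 0 → u ≡ v
  dist≡0⇒≡ {u} {v} eq = empty-walk (subst (Walk H u v) eq (geodesic u v))
    where
      empty-walk : ∀ {u v} → Walk H u v 0 → u ≡ v
      empty-walk [] = refl

  DistEq⇔ : ∀ {u v d} → DistEq H u v d ⇔ dist u v ≡ d
  DistEq⇔ {u} {v} {d} =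
    mk⇔ exact λ { refl → geodesic u v , λ m m<d q → <⇒≱ m<d (dist-≤ q) }
    where
      exact : DistEq H u v d → dist u v ≡ d
      exact (p , none-shorter) =
        ≤-antisym (dist-≤ p) (≮⇒≥ λ dist<d → none-shorter _ dist<d (geodesic u v))

  Ball⇔ : ∀ {r u x} → Ball H r u x ⇔ dist u x ≤ r
  Ball⇔ {r} {u} {x} = mk⇔ within inside
    where
      within : Ball H r u x → dist u x ≤ r
      within (inj₁ (_ , m , m≤r , p)) = ≤-trans (dist-≤ p) m≤r
      within (inj₂ refl) = subst (_≤ r) (Eq.sym (dist-self u)) z≤n

      inside : dist u x ≤ r → Ball H r u x
      inside le with u Fin.≟ x
      ... | yes u≡x = inj₂ (Eq.sym u≡x)
      ... | no u≢x = inj₁ (u≢x , dist u x , le , geodesic u x)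

  Adj⇔ : ∀ {u v} → Adj H u v ⇔ dist u v ≡ 1
  Adj⇔ {u} {v} = mk⇔ one edge
    where
      one : Adj H u v → dist u v ≡ 1
      one e = ≤-antisym (dist-≤ (e ∷ []))
                (n≢0⇒n>0 λ d≡0 → irrefl H (subst (Adj H u) (Eq.sym (dist≡0⇒≡ d≡0)) e))

      single : ∀ {u v} → Walk H u v 1 → Adj H u v
      single (e ∷ []) = e

      edge : dist u v ≡ 1 → Adj H u v
      edge eq = single (subst (Walk H u v) eq (geodesic u v))

  geodesic-split : ∀ {u x t} → t ≤ dist u x →
                   dist u (vertexAt (geodesic u x) t) ≡ t
                   × dist (vertexAt (geodesic u x) t) x ≡ dist u x ∸ t
  geodesic-split {u} {x} {t} t≤D =
    tight-sum (dist-≤ (prefix p t≤D)) (dist-≤ (suffix p t≤D))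
              (subst (_≤ dist u y + dist y x) (Eq.sym (m+[n∸m]≡n t≤D)) (dist-triangle u y x))
    where
      p : Walk H u x (dist u x)
      p = geodesic u x
      y : Fin n
      y = vertexAt p t

module Configuration {n : ℕ} (H : Graph n) (connected : Connected H) (r : ℕ) (v : ℕ → Fin n)
  (distinct : ∀ i j → i ≤ r → j ≤ r → v i ≡ v j → i ≡ j)
  (ball-last : ∀ x → Ball H r (v r) x ⇔ (∃ λ i → i ≤ r × x ≡ v i))
  (nested : ∀ i → i < r → ∀ x → Ball H r (v (suc i)) x → Ball H r (v i) x)
  (strict : ∀ i → i < r → ∃ λ x → Ball H r (v i) x × ¬ Ball H r (v (suc i)) x)
  (outside : ∃ λ x → ¬ Ball H r (v r) x) where

  open Metric H connected

  a : Fin n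
  a = v r

  in-ball-last : ∀ {x} → dist a x ≤ r → ∃ λ i → i ≤ r × x ≡ v i
  in-ball-last {x} le = to (ball-last x) (from Ball⇔ le)

  path-in-ball-last : ∀ {i} → i ≤ r → dist a (v i) ≤ r
  path-in-ball-last {i} i≤r = to Ball⇔ (from (ball-last (v i)) (i , i≤r , refl))

  descend : ∀ i k → i + k ≤ r → ∀ x → Ball H r (v (i + k)) x → Ball H r (v i) x
  descend i zero _ x b = subst (λ j → Ball H r (v j) x) (+-identityʳ i) b
  descend i (suc k) i+1+k≤r x b =
    nested i (<-≤-trans (m<m+n i (s≤s z≤n)) i+1+k≤r) x
      (descend (suc i) k (subst (_≤ r) (+-suc i k) i+1+k≤r) x
        (subst (λ j → Ball H r (v j) x) (+-suc i k) b))

  ball-last⊆ : ∀ {i x} → i ≤ r → dist a x ≤ r → dist (v i) x ≤ r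
  ball-last⊆ {i} {x} i≤r le =
    to Ball⇔ (descend i (r ∸ i) (≤-reflexive i+[r∸i]≡r) x
                (subst (λ j → Ball H r (v j) x) (Eq.sym i+[r∸i]≡r) (from Ball⇔ le)))
    where
      i+[r∸i]≡r : i + (r ∸ i) ≡ r
      i+[r∸i]≡r = m+[n∸m]≡n i≤r

  w : Fin n
  w = proj₁ outside

  r<dist-w : r < dist a w
  r<dist-w = ≰⇒> (proj₂ outside ∘ from Ball⇔)

  γ : ℕ → Fin n
  γ = vertexAt (geodesic a w)

  dist-γ : ∀ {t} → t ≤ r → dist a (γ t) ≡ t
  dist-γ t≤r = proj₁ (geodesic-split (≤-trans t≤r (<⇒≤ r<dist-w)))

  -- B_a is exactly the ray γ 0, …, γ r: the r+2 vertices y, γ 0, …, γ r all lie in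
  -- B_a = {v 0, …, v r}, and by pigeonhole two of them coincide; the γ's are pairwise
  -- distinct, so y is some γ t, and comparing distances to a gives t = k.
  ball-is-ray : ∀ {y k} → dist a y ≡ k → k ≤ r → y ≡ γ k
  ball-is-ray {y} {k} dist≡k k≤r = conclude (pigeonhole r R name)
    where
      candidate : ℕ → Fin n
      candidate zero = y
      candidate (suc t) = γ t

      R : ℕ → ℕ → Set
      R t i = v i ≡ candidate t

      name : ∀ t → t ≤ suc r → ∃ λ i → i ≤ r × R t i
      name zero _ with in-ball-last (subst (_≤ r) (Eq.sym dist≡k) k≤r)
      ... | i , i≤r , y≡vi = i , i≤r , Eq.sym y≡vi
      name (suc t) 1+t≤1+r with in-ball-last (≤-trans (≤-reflexive (dist-γ t≤r)) t≤r)
        where t≤r = s≤s⁻¹ 1+t≤1+r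
      ... | i , i≤r , γt≡vi = i , i≤r , Eq.sym γt≡vi

      conclude : (∃ λ s → ∃ λ t → s < t × t ≤ suc r × ∃ λ i → R s i × R t i) →
                 y ≡ γ k
      conclude (zero , suc t , _ , 1+t≤1+r , _ , vi≡y , vi≡γt) =
        subst (λ j → y ≡ γ j) t≡k y≡γt
        where
          y≡γt : y ≡ γ t
          y≡γt = trans (Eq.sym vi≡y) vi≡γt
          t≡k : t ≡ k
          t≡k = trans (Eq.sym (dist-γ (s≤s⁻¹ 1+t≤1+r)))
                      (trans (cong (dist a) (Eq.sym y≡γt)) dist≡k)
      conclude (suc s , suc t , 1+s<1+t , 1+t≤1+r , _ , vi≡γs , vi≡γt) =
        ⊥-elim (<⇒≢ s<t (trans (Eq.sym (dist-γ (≤-trans (<⇒≤ s<t) t≤r)))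
                          (trans (cong (dist a) (trans (Eq.sym vi≡γs) vi≡γt)) (dist-γ t≤r))))
        where
          s<t : s < t
          s<t = s≤s⁻¹ 1+s<1+t
          t≤r : t ≤ r
          t≤r = s≤s⁻¹ 1+t≤1+r

  -- Shortest walks from a run through B_a along the ray.
  through : ∀ {y x} → dist a y ≤ r → dist a y ≤ dist a x → dist a y + dist y x ≡ dist a x
  through {y} {x} y∈B le = begin
      dist a y + dist y x              ≡⟨ cong (λ u → dist a y + dist u x) y≡z ⟩
      dist a y + dist z x              ≡⟨ cong (dist a y +_) (proj₂ split) ⟩
      dist a y + (dist a x ∸ dist a y) ≡⟨ m+[n∸m]≡n le ⟩
      dist a x                         ∎
    where
      open ≡-Reasoning
      z : Fin n
      z = vertexAt (geodesic a x) (dist a y)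
      split : dist a z ≡ dist a y × dist z x ≡ dist a x ∸ dist a y
      split = geodesic-split le
      y≡z : y ≡ z
      y≡z = trans (ball-is-ray refl y∈B) (Eq.sym (ball-is-ray (proj₁ split) y∈B))

  pos : ℕ → ℕ
  pos i = dist a (v i)

  through-path : ∀ {i x} → i ≤ r → r < dist a x → pos i + dist (v i) x ≡ dist a x
  through-path i≤r r<dist =
    through (path-in-ball-last i≤r) (≤-trans (path-in-ball-last i≤r) (<⇒≤ r<dist))

  -- A witness of B_{v (i+1)} ⊊ B_{v i} lies outside B_a and is strictly closer to v i than
  -- to v (i+1); going through the ray, v (i+1) must therefore be nearer to a than v i.
  pos-decreasing : ∀ i → i < r → pos (suc i) < pos i
  pos-decreasing i i<r with strict i i<r
  ... | x , x∈Bi , x∉Bi+1 =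
    +-cancelʳ-< (dist (v i) x) (pos (suc i)) (pos i) (begin-strict
      pos (suc i) + dist (v i) x          ≤⟨ +-monoʳ-≤ (pos (suc i)) (to Ball⇔ x∈Bi) ⟩
      pos (suc i) + r                     <⟨ +-monoʳ-< (pos (suc i)) far-from-next ⟩
      pos (suc i) + dist (v (suc i)) x    ≡⟨ through-path i<r r<dist ⟩
      dist a x                            ≡⟨ Eq.sym (through-path (<⇒≤ i<r) r<dist) ⟩
      pos i + dist (v i) x                ∎)
    where
      open ≤-Reasoning
      far-from-next : r < dist (v (suc i)) x
      far-from-next = ≰⇒> (x∉Bi+1 ∘ from Ball⇔)
      r<dist : r < dist a x
      r<dist = ≰⇒> (x∉Bi+1 ∘ from Ball⇔ ∘ ball-last⊆ i<r)

  pos+index : ∀ {i} → i ≤ r → pos i + i ≡ r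
  pos+index = descending-staircase pos r pos-decreasing (path-in-ball-last z≤n) _

  dist-along-path : ∀ {i j} → i ≤ j → j ≤ r → dist (v j) (v i) + i ≡ j
  dist-along-path {i} {j} i≤j j≤r = +-cancelˡ-≡ (pos j) _ _ (begin
      pos j + (dist (v j) (v i) + i)  ≡⟨ Eq.sym (+-assoc (pos j) _ i) ⟩
      pos j + dist (v j) (v i) + i    ≡⟨ cong (_+ i) (through (path-in-ball-last j≤r) pos-j≤pos-i) ⟩
      pos i + i                       ≡⟨ pos+index i≤r ⟩
      r                               ≡⟨ Eq.sym (pos+index j≤r) ⟩
      pos j + j                       ∎)
    where
      open ≡-Reasoning
      i≤r : i ≤ r
      i≤r = ≤-trans i≤j j≤r
      pos-j≤pos-i : pos j ≤ pos i
      pos-j≤pos-i = +-cancelʳ-≤ j (pos j) (pos i)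
        (≤-trans (≤-reflexive (trans (pos+index j≤r) (Eq.sym (pos+index i≤r))))
                 (+-monoʳ-≤ (pos i) i≤j))

  dist-from-start : ∀ {j} → j ≤ r → dist (v 0) (v j) ≡ j
  dist-from-start {j} j≤r =
    trans (dist-sym (v 0) (v j)) (trans (Eq.sym (+-identityʳ _)) (dist-along-path z≤n j≤r))

  adjacent-ordered : ∀ {i j} → i ≤ j → j ≤ r → Adj H (v i) (v j) ⇔ j ≡ suc i
  adjacent-ordered {i} {j} i≤j j≤r = mk⇔
    (λ e → trans (Eq.sym (dist-along-path i≤j j≤r)) (cong (_+ i) (dist≡1 e)))
    (λ { refl → from Adj⇔ (trans (dist-sym (v i) (v j))
                                 (+-cancelʳ-≡ i _ 1 (dist-along-path i≤j j≤r))) })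
    where
      dist≡1 : Adj H (v i) (v j) → dist (v j) (v i) ≡ 1
      dist≡1 e = trans (dist-sym (v j) (v i)) (to Adj⇔ e)

  path-adjacency : ∀ i j → i ≤ r → j ≤ r → Adj H (v i) (v j) ⇔ (j ≡ suc i ⊎ i ≡ suc j)
  path-adjacency i j i≤r j≤r with ≤-total i j
  ... | inj₁ i≤j = mk⇔ (inj₁ ∘ to (adjacent-ordered i≤j j≤r))
    λ { (inj₁ j≡1+i) → from (adjacent-ordered i≤j j≤r) j≡1+i
      ; (inj₂ refl) → ⊥-elim (1+n≰n i≤j) }
  ... | inj₂ j≤i = mk⇔ (inj₂ ∘ to (adjacent-ordered j≤i i≤r) ∘ sym H)
    λ { (inj₂ i≡1+j) → sym H (from (adjacent-ordered j≤i i≤r) i≡1+j)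
      ; (inj₁ refl) → ⊥-elim (1+n≰n j≤i) }

  outside-dist : ∀ {i x} → i ≤ r → r < dist a x → dist (v i) x ≡ dist (v 0) x + i
  outside-dist {i} {x} i≤r r<dist = +-cancelˡ-≡ (pos i) _ _ (begin
      pos i + dist (v i) x          ≡⟨ through-path i≤r r<dist ⟩
      dist a x                      ≡⟨ Eq.sym (through-path z≤n r<dist) ⟩
      pos 0 + dist (v 0) x          ≡⟨ cong (_+ dist (v 0) x) pos0≡pos+i ⟩
      pos i + i + dist (v 0) x      ≡⟨ +-assoc (pos i) i _ ⟩
      pos i + (i + dist (v 0) x)    ≡⟨ cong (pos i +_) (+-comm i _) ⟩
      pos i + (dist (v 0) x + i)    ∎)
    where
      open ≡-Reasoning
      pos0≡pos+i : pos 0 ≡ pos i + i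
      pos0≡pos+i =
        trans (trans (Eq.sym (+-identityʳ (pos 0))) (pos+index z≤n)) (Eq.sym (pos+index i≤r))

  SphereShape : ℕ → Fin n → Set
  SphereShape d x = (Ball H r (v (r ∸ d)) x × ¬ Ball H r (v (r ∸ d + 1)) x) ⊎ x ≡ v d

  r∸d+1≤r : ∀ {d} → 1 ≤ d → d ≤ r → r ∸ d + 1 ≤ r
  r∸d+1≤r {d} 1≤d d≤r = ≤-trans (+-monoʳ-≤ (r ∸ d) 1≤d) (≤-reflexive (m∸n+n≡m d≤r))

  -- The sphere about v 0 inside B_a: both sides say x = v d.
  sphere-inside : ∀ d → 1 ≤ d → d ≤ r → ∀ {x} → dist a x ≤ r →
                  DistEq H (v 0) x d ⇔ SphereShape d x
  sphere-inside d 1≤d d≤r x∈Ba with in-ball-last x∈Ba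
  ... | j , j≤r , refl = mk⇔
    (λ at-d → inj₂ (cong v (trans (Eq.sym (dist-from-start j≤r)) (to DistEq⇔ at-d))))
    λ { (inj₁ (_ , x∉B)) → ⊥-elim (x∉B (from Ball⇔ (ball-last⊆ (r∸d+1≤r 1≤d d≤r) x∈Ba)))
      ; (inj₂ vj≡vd) →
          from DistEq⇔ (trans (dist-from-start j≤r) (distinct j d j≤r d≤r vj≡vd)) }

  -- The sphere about v 0 outside B_a: with E = dist (v 0) x, x ∈ B_{v (r-d)} iff E ≤ d and
  -- x ∈ B_{v (r-d+1)} iff E < d, so the difference of the balls is E = d.
  sphere-outside : ∀ d → 1 ≤ d → d ≤ r → ∀ {x} → r < dist a x →
                   DistEq H (v 0) x d ⇔ SphereShape d x
  sphere-outside d 1≤d d≤r {x} r<dist = mk⇔ on-sphere in-difference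
    where
      E : ℕ
      E = dist (v 0) x

      ball-outside : ∀ {i} → i ≤ r → Ball H r (v i) x ⇔ E + i ≤ r
      ball-outside i≤r = bound-by (outside-dist i≤r r<dist) ⇔-∘ Ball⇔

      in-first : Ball H r (v (r ∸ d)) x ⇔ E ≤ d
      in-first = shifted-bound d≤r ⇔-∘ ball-outside (m∸n≤m r d)

      E+[r∸d+1]≡1+E+[r∸d] : E + (r ∸ d + 1) ≡ suc E + (r ∸ d)
      E+[r∸d+1]≡1+E+[r∸d] = trans (cong (E +_) (+-comm (r ∸ d) 1)) (+-suc E (r ∸ d))

      in-second : Ball H r (v (r ∸ d + 1)) x ⇔ E < d
      in-second = shifted-bound d≤r
                  ⇔-∘ (bound-by E+[r∸d+1]≡1+E+[r∸d]
                  ⇔-∘ ball-outside (r∸d+1≤r 1≤d d≤r))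

      on-sphere : DistEq H (v 0) x d → SphereShape d x
      on-sphere at-d = inj₁ (from in-first (≤-reflexive E≡d) , λ b → <-irrefl E≡d (to in-second b))
        where
          E≡d : E ≡ d
          E≡d = to DistEq⇔ at-d

      in-difference : SphereShape d x → DistEq H (v 0) x d
      in-difference (inj₁ (b , nb)) =
        from DistEq⇔ (≤-antisym (to in-first b) (≮⇒≥ λ E<d → nb (from in-second E<d)))
      in-difference (inj₂ refl) = ⊥-elim (<⇒≱ r<dist (path-in-ball-last d≤r))

  sphere : ∀ d → 1 ≤ d → d ≤ r → ∀ x → DistEq H (v 0) x d ⇔ SphereShape d x
  sphere d 1≤d d≤r x with dist a x ≤? r
  ... | yes x∈Ba = sphere-inside d 1≤d d≤r x∈Ba
  ... | no x∉Ba = sphere-outside d 1≤d d≤r (≰⇒> x∉Ba)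

-- The theorem.  For r = 1 + r' the last strict inclusion B_{v r} ⊊ B_{v r'} provides a
-- vertex outside B_{v r}, and both claims are those of the configuration.
lemma1 : ∀ {n : ℕ} (H : Graph n) → Connected H → (r : ℕ) → 1 ≤ r →
    (v : ℕ → Fin n) →
    (∀ i j → i ≤ r → j ≤ r → v i ≡ v j → i ≡ j) →
    (∀ x → Ball H r (v r) x ⇔ (∃ λ i → i ≤ r × x ≡ v i)) →
    (∀ i → i < r →
      (∀ x → Ball H r (v (suc i)) x → Ball H r (v i) x)
      × (∃ λ x → Ball H r (v i) x × ¬ Ball H r (v (suc i)) x)) →
    (∀ i j → i ≤ r → j ≤ r → (Adj H (v i) (v j) ⇔ (j ≡ suc i ⊎ i ≡ suc j)))
    × (∀ d → 1 ≤ d → d ≤ r → ∀ x →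
        DistEq H (v 0) x d
          ⇔ ((Ball H r (v (r ∸ d)) x × ¬ Ball H r (v (r ∸ d + 1)) x) ⊎ x ≡ v d))
lemma1 H connected (suc r') _ v distinct ball-last steps = path-adjacency , sphere
  where
    outside : ∃ λ x → ¬ Ball H (suc r') (v (suc r')) x
    outside with proj₂ (steps r' ≤-refl)
    ... | x , _ , x∉B = x , x∉B

    open Configuration H connected (suc r') v distinct ball-last
           (λ i i<r → proj₁ (steps i i<r)) (λ i i<r → proj₂ (steps i i<r)) outside
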